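{- Let $\alpha$ be a composition of length $R$ with $\alpha\ne(1^R)$. In the ribbon diagram of $\alpha$, there are exactly $k-\delta_\alpha$ cells $x$ with the property that there are at least two cells above $x$ in the same column as $x$. These $k-\delta_\alpha$ cells occur in exactly $S'$ columns.
   Context: The ribbon diagram of $\alpha=\alpha_1\cdots\alpha_R$ (English convention, rows from the top) has $\alpha_i$ cells in row $i$, with the rightmost cell of row $i+1$ directly below the leftmost cell of row $i$. $k$ is the number of parts of $\alpha$ equal to $1$, and $\delta_\alpha=\chi(\alpha_1=1)+\chi(\alpha_R=1)$ (where $\chi(P)$ is $1$ if $P$ holds and $0$ otherwise). Write $\alpha=1^{p_1}z_11^{p_2}z_2\cdots1^{p_{R-k}}z_{R-k}1^{p_{R-k+1}}$ with all $p_i\ge0$ and $z_i\ge2$. Set $p'_1=p_1-1$, $p'_{R-k+1}=p_{R-k+1}-1$, $p'_i=p_i$ for $2\le i\le R-k$; $q'_j=|\{i:p'_i=j\}|$ for $j\ge0$; and $S'=\sum_{j\ge1}q'_j$. -}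

module Defs where

open import Data.Nat using (ℕ; zero; suc; _+_; _∸_; _≤_; _<_; _≟_; _≤?_; _<?_)
open import Data.Nat.ListAction using (sum)
open import Data.List using (List; []; _∷_; _++_; map; upTo; length; filter; deduplicate; last)
open import Data.Product using (_×_; _,_; proj₁; proj₂)
open import Data.Maybe using (Maybe; just; nothing)
open import Relation.Nullary using (Dec; yes; no)
open import Relation.Nullary.Decidable using (_×-dec_)
open import Relation.Binary.PropositionalEquality using (_≡_)
open import Data.Product.Properties using (≡-dec)

IsComposition : List ℕ → Set
IsComposition α = Data.List.Relation.Unary.All.All (λ a → 1 ≤ a) α
  where import Data.List.Relation.Unary.All

-- Cells are pairs (row , column); rows are numbered 0,1,… from the top
-- (English convention), columns are numbered left to right with the
-- leftmost cell of the bottom row in column 0.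
Cell : Set
Cell = ℕ × ℕ

-- Leftmost column of a row, given the parts of the rows strictly below it:
-- L_R = 0 and L_i = L_{i+1} + (α_{i+1} - 1), so that the rightmost cell of
-- row i+1 is directly below the leftmost cell of row i.
leftCol : List ℕ → ℕ
leftCol as = sum (map (λ a → a ∸ 1) as)

cellsFrom : ℕ → List ℕ → List Cell
cellsFrom i [] = []
cellsFrom i (a ∷ as) = map (λ c → (i , leftCol as + c)) (upTo a) ++ cellsFrom (suc i) as

ribbonCells : List ℕ → List Cell
ribbonCells α = cellsFrom 0 α

Above : Cell → Cell → Set
Above x y = (proj₁ y < proj₁ x) × (proj₂ y ≡ proj₂ x)

above? : (x y : Cell) → Dec (Above x y)
above? x y = (proj₁ y <? proj₁ x) ×-dec (proj₂ y ≟ proj₂ x)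

cellsAbove : List ℕ → Cell → ℕ
cellsAbove α x = length (filter (above? x) (ribbonCells α))

deepCells : List ℕ → List Cell
deepCells α = filter (λ x → 2 ≤? cellsAbove α x) (ribbonCells α)

deepColumnCount : List ℕ → ℕ
deepColumnCount α = length (deduplicate _≟_ (map proj₂ (deepCells α)))

-- k = number of parts equal to 1
numOnes : List ℕ → ℕ
numOnes α = length (filter (λ a → a ≟ 1) α)

χ1 : Maybe ℕ → ℕ
χ1 (just 1) = 1
χ1 _ = 0

headM : List ℕ → Maybe ℕ
headM [] = nothing
headM (a ∷ _) = just a

δ : List ℕ → ℕ
δ α = χ1 (headM α) + χ1 (last α)

-- runs α = (p_1, …, p_{R-k+1}) where α = 1^{p_1} z_1 1^{p_2} … z_{R-k} 1^{p_{R-k+1}}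
runs : List ℕ → List ℕ
runs [] = 0 ∷ []
runs (a ∷ as) with a ≟ 1 | runs as
... | yes _ | p ∷ ps = suc p ∷ ps
... | yes _ | [] = 1 ∷ []   -- unreachable: runs is never empty
... | no _  | ps = 0 ∷ ps

-- p'_i : subtract 1 from the first and last entries (truncated subtraction;
-- an entry p'_i = -1 would only contribute to q'_{-1}, which S' ignores)
dropLast1 : List ℕ → List ℕ
dropLast1 [] = []
dropLast1 (p ∷ []) = (p ∸ 1) ∷ []
dropLast1 (p ∷ q ∷ ps) = p ∷ dropLast1 (q ∷ ps)

primes : List ℕ → List ℕ
primes α with runs α
... | [] = []
... | p ∷ ps = (p ∸ 1) ∷ dropLast1 ps

q' : List ℕ → ℕ → ℕ
q' α j = length (filter (λ p → p ≟ j) (primes α))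

-- S' = Σ_{j ≥ 1} q'_j ; since every p'_i ≤ R = length α, the sum over
-- j = 1 … R is the whole sum.
sumFrom1 : (ℕ → ℕ) → ℕ → ℕ
sumFrom1 f zero = 0
sumFrom1 f (suc n) = sumFrom1 f n + f (suc n)

S' : List ℕ → ℕ
S' α = sumFrom1 (q' α) (length α)

-- Walk down the ribbon row by row.  Seen from a cell in row i or below and
-- in a column ≤ the rightmost column of row i, the rows above row i form a
-- single stack of m cells in that rightmost column (StackInv).  Passing to
-- row i+1 the stack grows by one when row i is a single cell and otherwise
-- restarts at height one (stackNext).  Hence only the rightmost cell of a row
-- can be deep, and the rightmost cell of row j+1 (j ≥ 1) is deep exactly
-- when α_j = 1: the deep cells of α = a ∷ β are  deepRows 1 β.
--
-- Two counts of deepRows finish the proof.  Its length is the number of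
-- parts equal to 1 among the parts of β but the last, i.e. k - δ_α.  Two of
-- its cells share a column exactly along consecutive ones, so its columns
-- correspond to the maximal runs of ones in β without its last part: the
-- nonzero entries of  dropLast1 (runs β), which is also what S' counts.
module Submission where

open import Defs
open import Data.Nat using (ℕ; zero; suc; _+_; _∸_; _≤_; _<_; _≟_; _≤?_; z≤n; s≤s)
open import Data.Nat.Properties
open import Data.List using (List; []; _∷_; _++_; map; upTo; applyUpTo; length; filter; replicate; deduplicate; last)
open import Data.List.Properties using (map-++; upTo-∷ʳ; filter-++; length-++; filter-none; filter-accept; filter-reject; filter-idem; filter-all; ∷-injective)
open import Data.List.Relation.Unary.All using (All; []; _∷_) renaming (map to all-map)
import Data.List.Relation.Unary.All.Properties as All
open import Data.Maybe using (just)
open import Data.Product using (_×_; _,_; proj₁; proj₂; ∃₂)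
open import Data.Empty using (⊥-elim)
open import Function using (_∘_; id)
open import Relation.Nullary using (Dec; ¬_; yes; no; ¬?)
open import Relation.Binary.PropositionalEquality
open import Algebra.Properties.CommutativeSemigroup +-commutativeSemigroup using (interchange)
open ≡-Reasoning

-- stack m L col: a stack of m cells in column L, as seen from column col.
stack : ℕ → ℕ → ℕ → ℕ
stack m L col with col ≟ L
... | yes _ = m
... | no  _ = 0

stack-here : ∀ m L → stack m L L ≡ m
stack-here m L with L ≟ L
... | yes _ = refl
... | no L≢L = ⊥-elim (L≢L refl)

stack-left : ∀ m L col → col < L → stack m L col ≡ 0
stack-left m L col col<L with col ≟ L
... | yes refl = ⊥-elim (<-irrefl refl col<L)
... | no  _    = refl

stack-empty : ∀ L col → stack 0 L col ≡ 0
stack-empty L col with col ≟ L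
... | yes _ = refl
... | no  _ = refl

-- Height of the stack over the rightmost cell of the next row, when the
-- current row has b cells and a stack of m cells over its rightmost cell.
stackNext : ℕ → ℕ → ℕ
stackNext (suc zero) m = suc m
stackNext _          m = 1

stackNext-pos : ∀ b m → 1 ≤ stackNext b m
stackNext-pos zero          m = s≤s z≤n
stackNext-pos (suc zero)    m = s≤s z≤n
stackNext-pos (suc (suc _)) m = s≤s z≤n

-- The top row sits under an empty stack and leaves a stack of height one.
stackNext-empty : ∀ b → stackNext b 0 ≡ 1
stackNext-empty zero          = refl
stackNext-empty (suc zero)    = refl
stackNext-empty (suc (suc _)) = refl

-- A row of 1+b cells with a stack of m over its rightmost column b + L adds
-- one cell to column L (its leftmost cell); for b = 0 the two stacks merge,
-- otherwise the old stack lies to the right of every column ≤ L.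
stack-step : ∀ b m L col → col ≤ L →
  stack m (b + L) col + stack 1 L col ≡ stack (stackNext (suc b) m) L col
stack-step zero m L col _ with col ≟ L
... | yes _ = +-comm m 1
... | no  _ = refl
stack-step (suc b) m L col col≤L =
  cong (_+ stack 1 L col) (stack-left m (suc b + L) col (s≤s (≤-trans col≤L (m≤n+m L b))))

aboveIn : Cell → List Cell → ℕ
aboveIn x ys = length (filter (above? x) ys)

aboveIn-++ : ∀ x ys zs → aboveIn x (ys ++ zs) ≡ aboveIn x ys + aboveIn x zs
aboveIn-++ x ys zs =
  trans (cong length (filter-++ (above? x) ys zs)) (length-++ (filter (above? x) ys))

rowCells : ℕ → ℕ → ℕ → List Cell
rowCells i L a = map (λ c → (i , L + c)) (upTo a)

notAbove-right : ∀ {r col} y → col < proj₂ y → ¬ Above (r , col) y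
notAbove-right y col<y (_ , same) = <-irrefl (sym same) col<y

cellsFrom-rows : ∀ i β → All (λ y → i ≤ proj₁ y) (cellsFrom i β)
cellsFrom-rows i [] = []
cellsFrom-rows i (b ∷ bs) =
  All.++⁺ (All.map⁺ (All.applyUpTo⁺₂ id b (λ _ → ≤-refl)))
          (all-map (≤-trans (n≤1+n i)) (cellsFrom-rows (suc i) bs))

aboveIn-sameRow : ∀ i c β → aboveIn (i , c) (cellsFrom i β) ≡ 0
aboveIn-sameRow i c β = cong length (filter-none (above? (i , c))
  (all-map (λ i≤y above → <-irrefl refl (<-≤-trans (proj₁ above) i≤y)) (cellsFrom-rows i β)))

rowTail-notAbove : ∀ i r col L b → col ≤ L →
  filter (above? (r , col)) (map (λ c → (i , L + c)) (applyUpTo suc b)) ≡ []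
rowTail-notAbove i r col L b col≤L = filter-none (above? (r , col))
  (All.map⁺ (All.applyUpTo⁺₂ suc b (λ c → notAbove-right (i , L + suc c)
    (≤-trans (s≤s (≤-trans col≤L (m≤m+n L c))) (≤-reflexive (sym (+-suc L c)))))))

aboveIn-row : ∀ i r col L b → i < r → col ≤ L →
  aboveIn (r , col) (rowCells i L (suc b)) ≡ stack 1 L col
aboveIn-row i r col L b i<r col≤L with col ≟ L
... | yes refl = trans
  (cong length (filter-accept (above? (r , col)) (i<r , +-identityʳ col)))
  (cong (suc ∘ length) (rowTail-notAbove i r col col b col≤L))
... | no col≢L = trans
  (cong length (filter-reject (above? (r , col)) (λ above → col≢L (trans (sym (proj₂ above)) (+-identityʳ L)))))
  (cong length (rowTail-notAbove i r col L b col≤L))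

-- StackInv α i β m: β lists the parts of α from row i on, and seen from any
-- cell in row ≥ i and column ≤ leftCol β (the rightmost column of row i), the
-- rows above row i contribute a stack of m cells in column leftCol β while
-- the rows of β contribute the rest.
StackInv : List ℕ → ℕ → List ℕ → ℕ → Set
StackInv α i β m = ∀ r col → i ≤ r → col ≤ leftCol β →
  cellsAbove α (r , col) ≡ stack m (leftCol β) col + aboveIn (r , col) (cellsFrom i β)

stackInv-top : ∀ α → StackInv α 0 α 0
stackInv-top α r col _ _ = cong (_+ cellsAbove α (r , col)) (sym (stack-empty (leftCol α) col))

-- Moving the invariant one row down: the row i joins the stack.
stackInv-step : ∀ α i b bs m → StackInv α i (suc b ∷ bs) m → StackInv α (suc i) bs (stackNext (suc b) m)
stackInv-step α i b bs m inv r col i<r col≤L = begin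
  cellsAbove α x
    ≡⟨ inv r col (≤-trans (n≤1+n i) i<r) (≤-trans col≤L (m≤n+m L b)) ⟩
  stack m (b + L) col + aboveIn x (rowCells i L (suc b) ++ cellsFrom (suc i) bs)
    ≡⟨ cong (stack m (b + L) col +_) (aboveIn-++ x (rowCells i L (suc b)) (cellsFrom (suc i) bs)) ⟩
  stack m (b + L) col + (aboveIn x (rowCells i L (suc b)) + aboveIn x (cellsFrom (suc i) bs))
    ≡⟨ sym (+-assoc (stack m (b + L) col) _ _) ⟩
  stack m (b + L) col + aboveIn x (rowCells i L (suc b)) + aboveIn x (cellsFrom (suc i) bs)
    ≡⟨ cong (λ n → stack m (b + L) col + n + aboveIn x (cellsFrom (suc i) bs)) (aboveIn-row i r col L b i<r col≤L) ⟩
  stack m (b + L) col + stack 1 L col + aboveIn x (cellsFrom (suc i) bs)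
    ≡⟨ cong (_+ aboveIn x (cellsFrom (suc i) bs)) (stack-step b m L col col≤L) ⟩
  stack (stackNext (suc b) m) L col + aboveIn x (cellsFrom (suc i) bs) ∎
  where
  L = leftCol bs
  x = (r , col)

cellsAbove-row : ∀ α i β m c → StackInv α i β m → c ≤ leftCol β →
  cellsAbove α (i , c) ≡ stack m (leftCol β) c
cellsAbove-row α i β m c inv c≤L = begin
  cellsAbove α (i , c)                                     ≡⟨ inv i c ≤-refl c≤L ⟩
  stack m (leftCol β) c + aboveIn (i , c) (cellsFrom i β)  ≡⟨ cong (stack m (leftCol β) c +_) (aboveIn-sameRow i c β) ⟩
  stack m (leftCol β) c + 0                                ≡⟨ +-identityʳ _ ⟩
  stack m (leftCol β) c                                    ∎

deep? : (α : List ℕ) (x : Cell) → Dec (2 ≤ cellsAbove α x)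
deep? α x = 2 ≤? cellsAbove α x

onlyIfDeep : ℕ → Cell → List Cell
onlyIfDeep (suc (suc _)) x = x ∷ []
onlyIfDeep _             _ = []

deep-single : ∀ α x m → cellsAbove α x ≡ m → filter (deep? α) (x ∷ []) ≡ onlyIfDeep m x
deep-single α x zero          above≡ =
  filter-reject (deep? α) (λ 2≤ → <⇒≱ (s≤s z≤n) (subst (2 ≤_) above≡ 2≤))
deep-single α x (suc zero)    above≡ =
  filter-reject (deep? α) (λ 2≤ → <⇒≱ (s≤s (s≤s z≤n)) (subst (2 ≤_) above≡ 2≤))
deep-single α x (suc (suc m)) above≡ =
  filter-accept (deep? α) (subst (2 ≤_) (sym above≡) (s≤s (s≤s z≤n)))

-- Only the rightmost cell of a row carries the stack, so it is the only
-- candidate for a deep cell.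
deepOfRow : ∀ α i b bs m → StackInv α i (suc b ∷ bs) m →
  filter (deep? α) (rowCells i (leftCol bs) (suc b)) ≡ onlyIfDeep m (i , b + leftCol bs)
deepOfRow α i b bs m inv = begin
  filter (deep? α) (map cell (upTo (suc b)))
    ≡⟨ cong (filter (deep? α) ∘ map cell) (sym (upTo-∷ʳ b)) ⟩
  filter (deep? α) (map cell (upTo b ++ b ∷ []))
    ≡⟨ cong (filter (deep? α)) (map-++ cell (upTo b) (b ∷ [])) ⟩
  filter (deep? α) (map cell (upTo b) ++ cell b ∷ [])
    ≡⟨ filter-++ (deep? α) (map cell (upTo b)) (cell b ∷ []) ⟩
  filter (deep? α) (map cell (upTo b)) ++ filter (deep? α) (cell b ∷ [])
    ≡⟨ cong₂ _++_ (filter-none (deep? α) (All.map⁺ (All.applyUpTo⁺₁ id b notDeep)))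
                  (deep-single α (cell b) m (trans (height b ≤-refl) stack-rightmost)) ⟩
  onlyIfDeep m (i , L + b)
    ≡⟨ cong (onlyIfDeep m ∘ (i ,_)) (+-comm L b) ⟩
  onlyIfDeep m (i , b + L) ∎
  where
  L = leftCol bs
  cell : ℕ → Cell
  cell c = (i , L + c)
  height : ∀ c → c ≤ b → cellsAbove α (cell c) ≡ stack m (b + L) (L + c)
  height c c≤b = cellsAbove-row α i (suc b ∷ bs) m (L + c) inv
    (≤-trans (+-monoʳ-≤ L c≤b) (≤-reflexive (+-comm L b)))
  stack-rightmost : stack m (b + L) (L + b) ≡ m
  stack-rightmost = trans (cong (stack m (b + L)) (+-comm L b)) (stack-here m (b + L))
  notDeep : ∀ {c} → c < b → ¬ 2 ≤ cellsAbove α (cell c)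
  notDeep {c} c<b 2≤ = <⇒≱ (s≤s z≤n) (subst (2 ≤_) (trans (height c (<⇒≤ c<b))
    (stack-left m (b + L) (L + c) (<-≤-trans (+-monoʳ-< L c<b) (≤-reflexive (+-comm L b))))) 2≤)

onlyIfOne : ℕ → Cell → List Cell
onlyIfOne (suc zero) x = x ∷ []
onlyIfOne _          _ = []

-- deepRows i (a_i ∷ a_{i+1} ∷ …): the rightmost cell of row j+1 for every
-- j ≥ i with a_j = 1 that is not the last part.
deepRows : ℕ → List ℕ → List Cell
deepRows i []           = []
deepRows i (p ∷ [])     = []
deepRows i (p ∷ b ∷ bs) = onlyIfOne p (suc i , leftCol (b ∷ bs)) ++ deepRows (suc i) (b ∷ bs)

onlyIfDeep-next : ∀ p m x → 1 ≤ m → onlyIfDeep (stackNext p m) x ≡ onlyIfOne p x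
onlyIfDeep-next zero          m       x _ = refl
onlyIfDeep-next (suc zero)    (suc m) x _ = refl
onlyIfDeep-next (suc (suc p)) m       x _ = refl

deepCells-below : ∀ α i p β m → 1 ≤ m → StackInv α (suc i) β (stackNext p m) → IsComposition β →
  filter (deep? α) (cellsFrom (suc i) β) ≡ deepRows i (p ∷ β)
deepCells-below α i p []           m _   _   []         = refl
deepCells-below α i p (suc b ∷ bs) m 1≤m inv (_ ∷ comp) = begin
  filter (deep? α) (rowCells (suc i) (leftCol bs) (suc b) ++ cellsFrom (suc (suc i)) bs)
    ≡⟨ filter-++ (deep? α) (rowCells (suc i) (leftCol bs) (suc b)) (cellsFrom (suc (suc i)) bs) ⟩
  filter (deep? α) (rowCells (suc i) (leftCol bs) (suc b)) ++ filter (deep? α) (cellsFrom (suc (suc i)) bs)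
    ≡⟨ cong₂ _++_
         (trans (deepOfRow α (suc i) b bs (stackNext p m) inv) (onlyIfDeep-next p m _ 1≤m))
         (deepCells-below α (suc i) (suc b) bs (stackNext p m) (stackNext-pos p m)
           (stackInv-step α (suc i) b bs (stackNext p m) inv) comp) ⟩
  deepRows i (p ∷ suc b ∷ bs) ∎

-- The deep cells of a ∷ β: the top row behaves like a row of length ≠ 1 (it
-- leaves a stack of height one), and it has no deep cell itself.
deepCells≡deepRows : ∀ a β → IsComposition (a ∷ β) → deepCells (a ∷ β) ≡ deepRows 1 β
deepCells≡deepRows (suc a) β (_ ∷ comp) = begin
  filter (deep? α) (rowCells 0 (leftCol β) (suc a) ++ cellsFrom 1 β)
    ≡⟨ filter-++ (deep? α) (rowCells 0 (leftCol β) (suc a)) (cellsFrom 1 β) ⟩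
  filter (deep? α) (rowCells 0 (leftCol β) (suc a)) ++ filter (deep? α) (cellsFrom 1 β)
    ≡⟨ cong₂ _++_ (deepOfRow α 0 a β 0 (stackInv-top α))
         (deepCells-below α 0 0 β 1 ≤-refl
           (subst (StackInv α 1 β) (stackNext-empty (suc a)) (stackInv-step α 0 a β 0 (stackInv-top α))) comp) ⟩
  deepRows 0 (0 ∷ β)
    ≡⟨ skipTop β ⟩
  deepRows 1 β ∎
  where
  α = suc a ∷ β
  skipTop : ∀ β → deepRows 0 (0 ∷ β) ≡ deepRows 1 β
  skipTop []      = refl
  skipTop (_ ∷ _) = refl

onesButLast : List ℕ → ℕ
onesButLast []           = 0
onesButLast (x ∷ [])     = 0
onesButLast (x ∷ y ∷ ys) = χ1 (just x) + onesButLast (y ∷ ys)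

length-deepRows : ∀ i xs → length (deepRows i xs) ≡ onesButLast xs
length-deepRows i []                     = refl
length-deepRows i (p ∷ [])               = refl
length-deepRows i (zero ∷ b ∷ bs)        = length-deepRows (suc i) (b ∷ bs)
length-deepRows i (suc zero ∷ b ∷ bs)    = cong suc (length-deepRows (suc i) (b ∷ bs))
length-deepRows i (suc (suc _) ∷ b ∷ bs) = length-deepRows (suc i) (b ∷ bs)

numOnes-∷ : ∀ y ys → numOnes (y ∷ ys) ≡ χ1 (just y) + numOnes ys
numOnes-∷ zero          ys = refl
numOnes-∷ (suc zero)    ys = refl
numOnes-∷ (suc (suc _)) ys = refl

numOnes-last : ∀ y ys → numOnes (y ∷ ys) ≡ onesButLast (y ∷ ys) + χ1 (last (y ∷ ys))
numOnes-last y []       = trans (numOnes-∷ y []) (+-comm (χ1 (just y)) 0)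
numOnes-last y (z ∷ zs) = begin
  numOnes (y ∷ z ∷ zs)                                           ≡⟨ numOnes-∷ y (z ∷ zs) ⟩
  χ1 (just y) + numOnes (z ∷ zs)                                 ≡⟨ cong (χ1 (just y) +_) (numOnes-last z zs) ⟩
  χ1 (just y) + (onesButLast (z ∷ zs) + χ1 (last (z ∷ zs)))     ≡⟨ sym (+-assoc (χ1 (just y)) _ _) ⟩
  χ1 (just y) + onesButLast (z ∷ zs) + χ1 (last (z ∷ zs))       ∎

onesButLast≡k-δ : ∀ a β → onesButLast β ≡ numOnes (a ∷ β) ∸ δ (a ∷ β)
onesButLast≡k-δ zero          [] = refl
onesButLast≡k-δ (suc zero)    [] = refl
onesButLast≡k-δ (suc (suc _)) [] = refl
onesButLast≡k-δ a (y ∷ ys) = sym (begin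
  numOnes (a ∷ y ∷ ys) ∸ (χ1 (just a) + ends)
    ≡⟨ cong (_∸ (χ1 (just a) + ends)) (trans (numOnes-∷ a (y ∷ ys)) (cong (χ1 (just a) +_) (numOnes-last y ys))) ⟩
  χ1 (just a) + (inner + ends) ∸ (χ1 (just a) + ends)
    ≡⟨ cong (λ n → χ1 (just a) + n ∸ (χ1 (just a) + ends)) (+-comm inner ends) ⟩
  χ1 (just a) + (ends + inner) ∸ (χ1 (just a) + ends)
    ≡⟨ cong (_∸ (χ1 (just a) + ends)) (sym (+-assoc (χ1 (just a)) ends inner)) ⟩
  χ1 (just a) + ends + inner ∸ (χ1 (just a) + ends)
    ≡⟨ m+n∸m≡n (χ1 (just a) + ends) inner ⟩
  inner ∎)
  where
  inner = onesButLast (y ∷ ys)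
  ends  = χ1 (last (y ∷ ys))

nonzeros : List ℕ → ℕ
nonzeros []           = 0
nonzeros (zero  ∷ xs) = nonzeros xs
nonzeros (suc _ ∷ xs) = suc (nonzeros xs)

distinctColumns : List Cell → ℕ
distinctColumns xs = length (deduplicate _≟_ (map proj₂ xs))

dedup-repeat : ∀ x ys → length (deduplicate _≟_ (x ∷ x ∷ ys)) ≡ length (deduplicate _≟_ (x ∷ ys))
dedup-repeat x ys = cong (suc ∘ length)
  (trans (filter-reject (¬? ∘ (x ≟_)) (λ x≢x → x≢x refl)) (filter-idem (¬? ∘ (x ≟_)) (deduplicate _≟_ ys)))

dedup-new : ∀ x ys → All (_< x) ys → length (deduplicate _≟_ (x ∷ ys)) ≡ suc (length (deduplicate _≟_ ys))
dedup-new x ys ys<x = cong (suc ∘ length) (filter-all (¬? ∘ (x ≟_))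
  (All.deduplicate⁺ _≟_ (all-map (λ y<x x≡y → <-irrefl (sym x≡y) y<x) ys<x)))

deepRows-columns : ∀ i p bs → All (_≤ leftCol bs) (map proj₂ (deepRows i (p ∷ bs)))
deepRows-columns i p [] = []
deepRows-columns i p (b ∷ cs) = first p
  where
  rest : All (_≤ leftCol (b ∷ cs)) (map proj₂ (deepRows (suc i) (b ∷ cs)))
  rest = all-map (λ le → ≤-trans le (m≤n+m (leftCol cs) (b ∸ 1))) (deepRows-columns (suc i) b cs)
  first : ∀ p → All (_≤ leftCol (b ∷ cs)) (map proj₂ (onlyIfOne p (suc i , leftCol (b ∷ cs)) ++ deepRows (suc i) (b ∷ cs)))
  first zero          = rest
  first (suc zero)    = ≤-refl ∷ rest
  first (suc (suc _)) = rest

runs-nonempty : ∀ as → ∃₂ λ p ps → runs as ≡ p ∷ ps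
runs-nonempty []                 = 0 , [] , refl
runs-nonempty (zero ∷ as)        = 0 , runs as , refl
runs-nonempty (suc (suc _) ∷ as) = 0 , runs as , refl
runs-nonempty (suc zero ∷ as) with runs-nonempty as
... | p , ps , eq rewrite eq = suc p , ps , refl

runs-one : ∀ as p ps → runs as ≡ p ∷ ps → runs (1 ∷ as) ≡ suc p ∷ ps
runs-one as p ps eq rewrite eq = refl

-- Since runs never returns [], its first entry is not the one shortened by
-- dropLast1 and contributes to the count on its own.
runs-front : ∀ x cs → nonzeros (dropLast1 (x ∷ runs cs)) ≡ nonzeros (x ∷ []) + nonzeros (dropLast1 (runs cs))
runs-front x cs with runs-nonempty cs
... | q , qs , eq = begin
  nonzeros (dropLast1 (x ∷ runs cs))               ≡⟨ cong (λ ps → nonzeros (dropLast1 (x ∷ ps))) eq ⟩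
  nonzeros (dropLast1 (x ∷ q ∷ qs))                ≡⟨ front x ⟩
  nonzeros (x ∷ []) + nonzeros (dropLast1 (q ∷ qs)) ≡⟨ cong (λ ps → nonzeros (x ∷ []) + nonzeros (dropLast1 ps)) eq ⟨
  nonzeros (x ∷ []) + nonzeros (dropLast1 (runs cs)) ∎
  where
  front : ∀ x → nonzeros (dropLast1 (x ∷ q ∷ qs)) ≡ nonzeros (x ∷ []) + nonzeros (dropLast1 (q ∷ qs))
  front zero    = refl
  front (suc _) = refl

-- Lengthening the leading run of ones of a list 1 ∷ c ∷ cs does not change
-- the count: that run stays nonempty even if dropLast1 shortens it.
runs-twoOnes : ∀ c cs → nonzeros (dropLast1 (runs (1 ∷ 1 ∷ c ∷ cs))) ≡ nonzeros (dropLast1 (runs (1 ∷ c ∷ cs)))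
runs-twoOnes zero          cs = trans (runs-front 2 cs) (sym (runs-front 1 cs))
runs-twoOnes (suc (suc _)) cs = trans (runs-front 2 cs) (sym (runs-front 1 cs))
runs-twoOnes (suc zero)    cs with runs-nonempty cs
... | q , qs , eq = begin
  nonzeros (dropLast1 (runs (1 ∷ 1 ∷ 1 ∷ cs)))  ≡⟨ cong (nonzeros ∘ dropLast1) (runs-one (1 ∷ 1 ∷ cs) _ qs r₂) ⟩
  nonzeros (dropLast1 (suc (suc (suc q)) ∷ qs)) ≡⟨ longRun qs ⟩
  nonzeros (dropLast1 (suc (suc q) ∷ qs))       ≡⟨ cong (nonzeros ∘ dropLast1) r₂ ⟨
  nonzeros (dropLast1 (runs (1 ∷ 1 ∷ cs)))      ∎
  where
  r₂ : runs (1 ∷ 1 ∷ cs) ≡ suc (suc q) ∷ qs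
  r₂ = runs-one (1 ∷ cs) (suc q) qs (runs-one cs q qs eq)
  longRun : ∀ qs → nonzeros (dropLast1 (suc (suc (suc q)) ∷ qs)) ≡ nonzeros (dropLast1 (suc (suc q) ∷ qs))
  longRun []      = refl
  longRun (_ ∷ _) = refl

-- Consecutive deep cells share a column exactly along a run of ones, so the
-- deep columns are counted by the runs of ones before the last part.
columns-deepRows : ∀ i xs → IsComposition xs → distinctColumns (deepRows i xs) ≡ nonzeros (dropLast1 (runs xs))
columns-deepRows i []                    _ = refl
columns-deepRows i (zero ∷ _)            (() ∷ _)
columns-deepRows i (suc zero ∷ [])       _ = refl
columns-deepRows i (suc (suc _) ∷ [])    _ = refl
columns-deepRows i (suc (suc _) ∷ b ∷ bs) (_ ∷ comp) =
  trans (columns-deepRows (suc i) (b ∷ bs) comp) (sym (runs-front 0 (b ∷ bs)))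
columns-deepRows i (suc zero ∷ zero ∷ _) (_ ∷ () ∷ _)
columns-deepRows i (suc zero ∷ suc zero ∷ []) _ = refl
columns-deepRows i (suc zero ∷ suc zero ∷ c ∷ cs) (_ ∷ comp) = begin
  length (deduplicate _≟_ (leftCol (c ∷ cs) ∷ leftCol (c ∷ cs) ∷ later))
    ≡⟨ dedup-repeat (leftCol (c ∷ cs)) later ⟩
  distinctColumns (deepRows (suc i) (1 ∷ c ∷ cs))
    ≡⟨ columns-deepRows (suc i) (1 ∷ c ∷ cs) comp ⟩
  nonzeros (dropLast1 (runs (1 ∷ c ∷ cs)))
    ≡⟨ runs-twoOnes c cs ⟨
  nonzeros (dropLast1 (runs (1 ∷ 1 ∷ c ∷ cs))) ∎
  where
  later = map proj₂ (deepRows (suc (suc i)) (c ∷ cs))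
-- A part ≥ 2 after a deep cell moves all later deep cells strictly left of it.
columns-deepRows i (suc zero ∷ suc (suc k) ∷ bs) (_ ∷ comp) =
  trans (dedup-new (suc k + leftCol bs) _
          (all-map (λ le → s≤s (≤-trans le (m≤n+m (leftCol bs) k))) (deepRows-columns (suc i) (suc (suc k)) bs)))
        (trans (cong suc (columns-deepRows (suc i) (suc (suc k) ∷ bs) comp))
               (trans (cong suc (runs-front 0 bs)) (sym (runs-front 1 bs))))

occurrences : ℕ → List ℕ → ℕ
occurrences j xs = length (filter (_≟ j) xs)

occurrences-∷ : ∀ j x xs → occurrences j (x ∷ xs) ≡ occurrences j (x ∷ []) + occurrences j xs
occurrences-∷ j x xs with x ≟ j
... | yes x≡j = trans (cong length (filter-accept (_≟ j) {xs = xs} x≡j))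
                      (cong (_+ occurrences j xs) (sym (cong length (filter-accept (_≟ j) {xs = []} x≡j))))
... | no  x≢j = trans (cong length (filter-reject (_≟ j) {xs = xs} x≢j))
                      (cong (_+ occurrences j xs) (sym (cong length (filter-reject (_≟ j) {xs = []} x≢j))))

sumFrom1-cong : ∀ f g n → (∀ j → f j ≡ g j) → sumFrom1 f n ≡ sumFrom1 g n
sumFrom1-cong f g zero    f≗g = refl
sumFrom1-cong f g (suc n) f≗g = cong₂ _+_ (sumFrom1-cong f g n f≗g) (f≗g (suc n))

sumFrom1-+ : ∀ f g n → sumFrom1 (λ j → f j + g j) n ≡ sumFrom1 f n + sumFrom1 g n
sumFrom1-+ f g zero    = refl
sumFrom1-+ f g (suc n) = trans (cong (_+ (f (suc n) + g (suc n))) (sumFrom1-+ f g n))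
                               (interchange (sumFrom1 f n) (sumFrom1 g n) (f (suc n)) (g (suc n)))

occurrences-self : ∀ x → occurrences x (x ∷ []) ≡ 1
occurrences-self x = cong length (filter-accept (_≟ x) {xs = []} refl)

occurrences-other : ∀ j x → x ≢ j → occurrences j (x ∷ []) ≡ 0
occurrences-other j x x≢j = cong length (filter-reject (_≟ j) {xs = []} x≢j)

sumFrom1-beyond : ∀ n x → n < x → sumFrom1 (λ j → occurrences j (x ∷ [])) n ≡ 0
sumFrom1-beyond zero    x _   = refl
sumFrom1-beyond (suc n) x n<x = cong₂ _+_ (sumFrom1-beyond n x (<-trans (n<1+n n) n<x))
                                          (occurrences-other (suc n) x (λ x≡n → <-irrefl (sym x≡n) n<x))

sumFrom1-single : ∀ n x → x ≤ n → sumFrom1 (λ j → occurrences j (x ∷ [])) n ≡ nonzeros (x ∷ [])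
sumFrom1-single zero    zero z≤n = refl
sumFrom1-single (suc n) x    x≤n with x ≟ suc n
... | yes refl = cong₂ _+_ (sumFrom1-beyond n (suc n) (n<1+n n)) (occurrences-self (suc n))
... | no  x≢n  = trans (cong₂ _+_ (sumFrom1-single n x (≤-pred (≤∧≢⇒< x≤n x≢n))) (occurrences-other (suc n) x x≢n))
                       (+-identityʳ _)

sumFrom1-zero : ∀ n → sumFrom1 (λ _ → 0) n ≡ 0
sumFrom1-zero zero    = refl
sumFrom1-zero (suc n) = cong (_+ 0) (sumFrom1-zero n)

sumFrom1-occurrences : ∀ n xs → All (_≤ n) xs → sumFrom1 (λ j → occurrences j xs) n ≡ nonzeros xs
sumFrom1-occurrences n []       []            = sumFrom1-zero n
sumFrom1-occurrences n (x ∷ xs) (x≤n ∷ xs≤n) = begin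
  sumFrom1 (λ j → occurrences j (x ∷ xs)) n
    ≡⟨ sumFrom1-cong _ _ n (λ j → occurrences-∷ j x xs) ⟩
  sumFrom1 (λ j → occurrences j (x ∷ []) + occurrences j xs) n
    ≡⟨ sumFrom1-+ (λ j → occurrences j (x ∷ [])) (λ j → occurrences j xs) n ⟩
  sumFrom1 (λ j → occurrences j (x ∷ [])) n + sumFrom1 (λ j → occurrences j xs) n
    ≡⟨ cong₂ _+_ (sumFrom1-single n x x≤n) (sumFrom1-occurrences n xs xs≤n) ⟩
  nonzeros (x ∷ []) + nonzeros xs
    ≡⟨ nonzeros-∷ x ⟨
  nonzeros (x ∷ xs) ∎
  where
  nonzeros-∷ : ∀ x → nonzeros (x ∷ xs) ≡ nonzeros (x ∷ []) + nonzeros xs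
  nonzeros-∷ zero    = refl
  nonzeros-∷ (suc _) = refl

runs-bounded : ∀ β → All (_≤ length β) (runs β)
runs-bounded []                 = z≤n ∷ []
runs-bounded (zero ∷ bs)        = z≤n ∷ all-map m≤n⇒m≤1+n (runs-bounded bs)
runs-bounded (suc (suc _) ∷ bs) = z≤n ∷ all-map m≤n⇒m≤1+n (runs-bounded bs)
runs-bounded (suc zero ∷ bs) with runs-nonempty bs
... | q , qs , eq with subst (All (_≤ length bs)) eq (runs-bounded bs)
... | q≤ ∷ qs≤ = subst (All (_≤ suc (length bs))) (sym (runs-one bs q qs eq)) (s≤s q≤ ∷ all-map m≤n⇒m≤1+n qs≤)

dropLast1-bounded : ∀ n xs → All (_≤ n) xs → All (_≤ n) (dropLast1 xs)
dropLast1-bounded n []           []           = []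
dropLast1-bounded n (x ∷ [])     (x≤n ∷ [])   = ≤-trans (m∸n≤m x 1) x≤n ∷ []
dropLast1-bounded n (x ∷ y ∷ ys) (x≤n ∷ ys≤n) = x≤n ∷ dropLast1-bounded n (y ∷ ys) ys≤n

primes-of : ∀ α p ps → runs α ≡ p ∷ ps → primes α ≡ (p ∸ 1) ∷ dropLast1 ps
primes-of α p ps eq rewrite eq = refl

primes-bounded : ∀ α → All (_≤ length α) (primes α)
primes-bounded α with runs-nonempty α
... | p , ps , eq with subst (All (_≤ length α)) eq (runs-bounded α)
... | p≤ ∷ ps≤ = subst (All (_≤ length α)) (sym (primes-of α p ps eq))
                   (≤-trans (m∸n≤m p 1) p≤ ∷ dropLast1-bounded (length α) ps ps≤)

S'≡nonzeros : ∀ α → S' α ≡ nonzeros (primes α)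
S'≡nonzeros α = sumFrom1-occurrences (length α) (primes α) (primes-bounded α)

runs-single⇒ones : ∀ β p → runs β ≡ p ∷ [] → β ≡ replicate (length β) 1
runs-single⇒ones [] p eq = refl
runs-single⇒ones (zero ∷ bs) p eq with runs-nonempty bs
... | q , qs , e with trans (sym e) (proj₂ (∷-injective eq))
... | ()
runs-single⇒ones (suc (suc _) ∷ bs) p eq with runs-nonempty bs
... | q , qs , e with trans (sym e) (proj₂ (∷-injective eq))
... | ()
runs-single⇒ones (suc zero ∷ bs) p eq with runs-nonempty bs
... | q , qs , e with proj₂ (∷-injective (trans (sym (runs-one bs q qs e)) eq))
... | refl = cong (1 ∷_) (runs-single⇒ones bs q e)

-- Unless α = a ∷ β is all ones, the nonzero p'_i are the runs of ones of β
-- before its last part (p'_1 = p_1 - 1 discounts the first part a).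
primes-nonzeros : ∀ a β → a ∷ β ≢ replicate (length (a ∷ β)) 1 →
  nonzeros (primes (a ∷ β)) ≡ nonzeros (dropLast1 (runs β))
primes-nonzeros zero          β _ = refl
primes-nonzeros (suc (suc _)) β _ = refl
primes-nonzeros (suc zero)    β notOnes with runs-nonempty β
... | p , []     , eq = ⊥-elim (notOnes (cong (1 ∷_) (runs-single⇒ones β p eq)))
... | p , q ∷ qs , eq = begin
  nonzeros (primes (1 ∷ β))         ≡⟨ cong nonzeros (primes-of (1 ∷ β) (suc p) (q ∷ qs) (runs-one β p (q ∷ qs) eq)) ⟩
  nonzeros (dropLast1 (p ∷ q ∷ qs)) ≡⟨ cong (nonzeros ∘ dropLast1) eq ⟨
  nonzeros (dropLast1 (runs β))     ∎

lemma3p14 : (α : List ℕ) → IsComposition α → α ≢ replicate (length α) 1 →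
    (length (deepCells α) ≡ numOnes α ∸ δ α) × (deepColumnCount α ≡ S' α)
lemma3p14 []      _                  notOnes = ⊥-elim (notOnes refl)
lemma3p14 (a ∷ β) comp@(_ ∷ compβ) notOnes = countCells , countColumns
  where
  countCells : length (deepCells (a ∷ β)) ≡ numOnes (a ∷ β) ∸ δ (a ∷ β)
  countCells = begin
    length (deepCells (a ∷ β)) ≡⟨ cong length (deepCells≡deepRows a β comp) ⟩
    length (deepRows 1 β)      ≡⟨ length-deepRows 1 β ⟩
    onesButLast β              ≡⟨ onesButLast≡k-δ a β ⟩
    numOnes (a ∷ β) ∸ δ (a ∷ β) ∎
  countColumns : deepColumnCount (a ∷ β) ≡ S' (a ∷ β)
  countColumns = begin
    deepColumnCount (a ∷ β)          ≡⟨ cong distinctColumns (deepCells≡deepRows a β comp) ⟩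
    distinctColumns (deepRows 1 β)   ≡⟨ columns-deepRows 1 β compβ ⟩
    nonzeros (dropLast1 (runs β))    ≡⟨ primes-nonzeros a β notOnes ⟨
    nonzeros (primes (a ∷ β))        ≡⟨ S'≡nonzeros (a ∷ β) ⟨
    S' (a ∷ β)                       ∎
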